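{- Let $\mathcal V$ be a finitely generated variety of SMB algebras, let $\mathbf A=(A;\wedge,d)\in\mathcal V$ be an SMB algebra over the congruence ${\sim}$, and let $\sqcap$ be a binary term of $\mathcal V$ such that, for some ternary term $q$ of $\mathcal V$, $(A;\sqcap^{\mathbf A},q^{\mathbf A})$ is a regular SMB algebra over ${\sim}$. Then for all $a,b,c,e\in A$: $(c,e)\in\mathrm{Cg}^{\mathbf A}(a,b)\vee{\sim}$ if and only if $(c,e\sqcap c)\in\mathrm{Cg}^{\mathbf A}(a,b)$ and $(e,c\sqcap e)\in\mathrm{Cg}^{\mathbf A}(a,b)$.
   Context: An algebra $(A;\wedge,d)$ is idempotent if $x\wedge x=x$ and $d(x,x,x)=x$. For a congruence ${\sim}$, it is an SMB algebra over ${\sim}$ if it is idempotent, $(A/{\sim};\wedge)$ is a semilattice, and on each ${\sim}$-class $\wedge$ is the second projection and $d$ is a Mal'cev operation ($d(x,y,y)=x=d(y,y,x)$). With $[u]_{\sim}\le[v]_{\sim}$ iff $[u]_{\sim}\wedge[v]_{\sim}=[u]_{\sim}$, an SMB algebra over ${\sim}$ is regular if (i) $[d(a,b,c)]_{\sim}=[(a\wedge b)\wedge c]_{\sim}$; (ii) $a\wedge b=b$ whenever $[a]_{\sim}\ge[b]_{\sim}$; (iii) $d(x,y,z)\approx d((y\wedge z)\wedge x,(x\wedge z)\wedge y,(x\wedge y)\wedge z)$ holds; (iv) $(x\wedge y)\wedge y\approx x\wedge y$ holds. A variety of SMB algebras is a variety in the language $\{\wedge,d\}$ all of whose members are SMB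 algebras; finitely generated means generated by one finite algebra. Members of $\mathcal V$ may be infinite. -}

module Defs where

open import Level using (Level; _⊔_) renaming (suc to lsuc; zero to 0ℓ)
open import Data.Nat using (ℕ)
open import Data.Fin using (Fin; zero; suc)
open import Data.Product using (Σ; _×_; _,_)
open import Relation.Binary.PropositionalEquality using (_≡_)

record Algebra : Set₁ where
  field
    Carrier : Set
    _∧_     : Carrier → Carrier → Carrier
    d       : Carrier → Carrier → Carrier → Carrier

record FinAlgebra (n : ℕ) : Set where
  field
    _∧_ : Fin n → Fin n → Fin n
    d   : Fin n → Fin n → Fin n → Fin n

toAlgebra : ∀ {n} → FinAlgebra n → Algebra
toAlgebra {n} F = record { Carrier = Fin n ; _∧_ = FinAlgebra._∧_ F ; d = FinAlgebra.d F }

data Term (X : Set) : Set where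
  var  : X → Term X
  meet : Term X → Term X → Term X
  dt   : Term X → Term X → Term X → Term X

⟦_⟧ : ∀ {X} → Term X → (A : Algebra) → (X → Algebra.Carrier A) → Algebra.Carrier A
⟦ var x ⟧      A ρ = ρ x
⟦ meet s t ⟧   A ρ = Algebra._∧_ A (⟦ s ⟧ A ρ) (⟦ t ⟧ A ρ)
⟦ dt s t u ⟧   A ρ = Algebra.d A (⟦ s ⟧ A ρ) (⟦ t ⟧ A ρ) (⟦ u ⟧ A ρ)

binOp : Term (Fin 2) → (A : Algebra) → Algebra.Carrier A → Algebra.Carrier A → Algebra.Carrier A
binOp t A x y = ⟦ t ⟧ A ρ
  where
  ρ : Fin 2 → Algebra.Carrier A
  ρ zero    = x
  ρ (suc _) = y

ternOp : Term (Fin 3) → (A : Algebra)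
       → Algebra.Carrier A → Algebra.Carrier A → Algebra.Carrier A → Algebra.Carrier A
ternOp t A x y z = ⟦ t ⟧ A ρ
  where
  ρ : Fin 3 → Algebra.Carrier A
  ρ zero          = x
  ρ (suc zero)    = y
  ρ (suc (suc _)) = z

-- Identities (over countably many variables) and the variety generated
-- by a finite algebra F: the class Mod(Id(F)) of all algebras satisfying
-- every identity of F (= HSP(F) by Birkhoff's theorem).

_⊨_≈_ : Algebra → Term ℕ → Term ℕ → Set
A ⊨ s ≈ t = (ρ : ℕ → Algebra.Carrier A) → ⟦ s ⟧ A ρ ≡ ⟦ t ⟧ A ρ

InVariety : ∀ {n} → FinAlgebra n → Algebra → Set
InVariety F A = (s t : Term ℕ) → toAlgebra F ⊨ s ≈ t → A ⊨ s ≈ t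

-- Structures (A; m, p) with a binary and a ternary operation, given
-- directly by the operations (so that term reducts can be used).

module _ {A : Set} where

  record IsCongruence {ℓ : Level}
           (m : A → A → A) (p : A → A → A → A) (θ : A → A → Set ℓ) : Set ℓ where
    field
      refl′  : ∀ x → θ x x
      sym′   : ∀ {x y} → θ x y → θ y x
      trans′ : ∀ {x y z} → θ x y → θ y z → θ x z
      m-cong : ∀ {x x′ y y′} → θ x x′ → θ y y′ → θ (m x y) (m x′ y′)
      p-cong : ∀ {x x′ y y′ z z′} → θ x x′ → θ y y′ → θ z z′
               → θ (p x y z) (p x′ y′ z′)

  -- SMB algebra (A; m, p) over the congruence ~ .
  -- The semilattice laws of (A/~; m) are written on representatives.
  record IsSMB (m : A → A → A) (p : A → A → A → A) (_~_ : A → A → Set) : Set where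
    field
      idem-m    : ∀ x → m x x ≡ x
      idem-p    : ∀ x → p x x x ≡ x
      congr     : IsCongruence m p _~_
      quot-idem : ∀ x → m x x ~ x
      quot-comm : ∀ x y → m x y ~ m y x
      quot-assoc : ∀ x y z → m (m x y) z ~ m x (m y z)
      class-proj₂ : ∀ {x y} → x ~ y → m x y ≡ y
      class-malcevˡ : ∀ {x y} → x ~ y → p x y y ≡ x
      class-malcevʳ : ∀ {x y} → x ~ y → p y y x ≡ x

  _≤[_,_]_ : A → (A → A → A) → (A → A → Set) → A → Set
  u ≤[ m , _~_ ] v = m u v ~ u

  record IsRegularSMB (m : A → A → A) (p : A → A → A → A) (_~_ : A → A → Set) : Set where
    field
      smb  : IsSMB m p _~_
      reg1 : ∀ a b c → p a b c ~ m (m a b) c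
      reg2 : ∀ a b → b ≤[ m , _~_ ] a → m a b ≡ b
      reg3 : ∀ x y z → p x y z ≡ p (m (m y z) x) (m (m x z) y) (m (m x y) z)
      reg4 : ∀ x y → m (m x y) y ≡ m x y

IsCon : (A : Algebra) → (Algebra.Carrier A → Algebra.Carrier A → Set) → Set
IsCon A θ = IsCongruence (Algebra._∧_ A) (Algebra.d A) θ

IsSMBAlg : (A : Algebra) → (Algebra.Carrier A → Algebra.Carrier A → Set) → Set
IsSMBAlg A _~_ = IsSMB (Algebra._∧_ A) (Algebra.d A) _~_

Cg : (A : Algebra) → (a b : Algebra.Carrier A) → Algebra.Carrier A → Algebra.Carrier A → Set₁
Cg A a b x y = (θ : Algebra.Carrier A → Algebra.Carrier A → Set) → IsCon A θ → θ a b → θ x y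

Join : (A : Algebra)
     → {ℓ₁ ℓ₂ : Level}
     → (Algebra.Carrier A → Algebra.Carrier A → Set ℓ₁)
     → (Algebra.Carrier A → Algebra.Carrier A → Set ℓ₂)
     → Algebra.Carrier A → Algebra.Carrier A → Set (lsuc 0ℓ ⊔ ℓ₁ ⊔ ℓ₂)
Join A R S x y = (ψ : Algebra.Carrier A → Algebra.Carrier A → Set) → IsCon A ψ
               → (∀ u v → R u v → ψ u v) → (∀ u v → S u v → ψ u v) → ψ x y

IsSMBVariety : ∀ {n} → FinAlgebra n → Set₁
IsSMBVariety F = (B : Algebra) → InVariety F B
               → Σ (Algebra.Carrier B → Algebra.Carrier B → Set) (λ _~_ → IsSMBAlg B _~_)

{-# OPTIONS --safe #-}
module Submission where

-- For a congruence θ of A put  x ψθ y  iff  θ(x, y ⊓ x) and θ(y, x ⊓ y).  Regularity of the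
-- reduct makes ψθ transitive, and ψθ is then a congruence of A containing θ and ~, while
-- conversely c θ (e ⊓ c) ~ (c ⊓ e) θ e.  Hence the join θ ∨ ~ equals ψθ, and taking
-- θ = Cg(a,b) gives the corollary.

open import Defs
open import Data.Nat using (ℕ)
open import Data.Fin using (Fin; zero; suc)
open import Data.Product using (_×_; _,_; proj₁; proj₂)
open import Function.Bundles using (_⇔_; mk⇔)
open import Relation.Binary.Bundles using (Setoid)
open import Relation.Binary.PropositionalEquality using (_≡_; cong)
import Relation.Binary.Reasoning.Setoid as SetoidReasoning

module _ (A : Algebra) where
  open Algebra A using (Carrier)

  ⟦⟧-cong : ∀ {θ : Carrier → Carrier → Set} → IsCon A θ
          → ∀ {X} (t : Term X) {ρ ρ′ : X → Carrier} → (∀ x → θ (ρ x) (ρ′ x))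
          → θ (⟦ t ⟧ A ρ) (⟦ t ⟧ A ρ′)
  ⟦⟧-cong θ-isCon (var x) ρ≈ρ′ = ρ≈ρ′ x
  ⟦⟧-cong θ-isCon (meet s t) ρ≈ρ′ =
    IsCongruence.m-cong θ-isCon (⟦⟧-cong θ-isCon s ρ≈ρ′) (⟦⟧-cong θ-isCon t ρ≈ρ′)
  ⟦⟧-cong θ-isCon (dt s t u) ρ≈ρ′ =
    IsCongruence.p-cong θ-isCon
      (⟦⟧-cong θ-isCon s ρ≈ρ′) (⟦⟧-cong θ-isCon t ρ≈ρ′) (⟦⟧-cong θ-isCon u ρ≈ρ′)

  binOp-cong : ∀ {θ : Carrier → Carrier → Set} → IsCon A θ → (t : Term (Fin 2))
             → ∀ {x x′ y y′} → θ x x′ → θ y y′ → θ (binOp t A x y) (binOp t A x′ y′)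
  binOp-cong θ-isCon t x≈x′ y≈y′ = ⟦⟧-cong θ-isCon t λ { zero → x≈x′ ; (suc _) → y≈y′ }

  congruenceSetoid : {θ : Carrier → Carrier → Set} → IsCon A θ → Setoid _ _
  congruenceSetoid {θ} θ-isCon = record
    { Carrier = Carrier
    ; _≈_ = θ
    ; isEquivalence = record { refl = refl′ _ ; sym = sym′ ; trans = trans′ }
    }
    where open IsCongruence θ-isCon

module RegularReduct
  (A : Algebra) (_~_ : Algebra.Carrier A → Algebra.Carrier A → Set) (~-isCon : IsCon A _~_)
  (⊓-term : Term (Fin 2)) (q : Term (Fin 3)) (regular : IsRegularSMB (binOp ⊓-term A) (ternOp q A) _~_)
  where

  open Algebra A using (Carrier)
  open IsRegularSMB regular using (smb; reg2)
  open IsSMB smb using (quot-comm; quot-assoc; class-proj₂)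

  infixl 25 _⊓_
  _⊓_ : Carrier → Carrier → Carrier
  _⊓_ = binOp ⊓-term A

  ⊓-absorbˡ : ∀ {u v} w → u ~ v → u ⊓ (v ⊓ w) ≡ v ⊓ w
  ⊓-absorbˡ {u} {v} w u~v = reg2 u (v ⊓ w) (begin
    (v ⊓ w) ⊓ u    ≈⟨ quot-comm (v ⊓ w) u ⟩
    u ⊓ (v ⊓ w)    ≈⟨ quot-assoc u v w ⟨
    (u ⊓ v) ⊓ w    ≡⟨ cong (_⊓ w) (class-proj₂ u~v) ⟩
    v ⊓ w          ∎)
    where open SetoidReasoning (congruenceSetoid A ~-isCon)

  MeetJoin : (Carrier → Carrier → Set) → Carrier → Carrier → Set
  MeetJoin θ x y = θ x (y ⊓ x) × θ y (x ⊓ y)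

  module _ {θ : Carrier → Carrier → Set} (θ-isCon : IsCon A θ) where
    open IsCongruence θ-isCon
    open SetoidReasoning (congruenceSetoid A θ-isCon)

    ⊓-cong : ∀ {x x′ y y′} → θ x x′ → θ y y′ → θ (x ⊓ y) (x′ ⊓ y′)
    ⊓-cong = binOp-cong A θ-isCon ⊓-term

    θ∘~∘θ⊆MeetJoin : ∀ {u u′ v′ v} → θ u u′ → u′ ~ v′ → θ v′ v → MeetJoin θ u v
    θ∘~∘θ⊆MeetJoin {u} {u′} {v′} {v} u≈u′ u′~v′ v′≈v =
        (begin
          u          ≈⟨ u≈u′ ⟩
          u′         ≡⟨ class-proj₂ (IsCongruence.sym′ ~-isCon u′~v′) ⟨
          v′ ⊓ u′    ≈⟨ ⊓-cong v′≈v (sym′ u≈u′) ⟩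
          v ⊓ u      ∎)
      , (begin
          v          ≈⟨ v′≈v ⟨
          v′         ≡⟨ class-proj₂ u′~v′ ⟨
          u′ ⊓ v′    ≈⟨ ⊓-cong (sym′ u≈u′) v′≈v ⟩
          u ⊓ v      ∎)

    θ⊆MeetJoin : ∀ {u v} → θ u v → MeetJoin θ u v
    θ⊆MeetJoin {u} u≈v = θ∘~∘θ⊆MeetJoin (refl′ u) (IsCongruence.refl′ ~-isCon u) u≈v

    ~⊆MeetJoin : ∀ {u v} → u ~ v → MeetJoin θ u v
    ~⊆MeetJoin {u} {v} u~v = θ∘~∘θ⊆MeetJoin (refl′ u) u~v (refl′ v)

    MeetJoin-transˡ : ∀ {x y z} → MeetJoin θ x y → MeetJoin θ y z → θ x (z ⊓ x)
    MeetJoin-transˡ {x} {y} {z} (x≈y⊓x , y≈x⊓y) (y≈z⊓y , z≈y⊓z) = sym′ (begin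
      z ⊓ x                            ≈⟨ ⊓-cong z≈y⊓z x≈y⊓x ⟩
      (y ⊓ z) ⊓ (y ⊓ x)                ≡⟨ cong ((y ⊓ z) ⊓_) (class-proj₂ (quot-comm x y)) ⟨
      (y ⊓ z) ⊓ ((x ⊓ y) ⊓ (y ⊓ x))    ≈⟨ ⊓-cong (refl′ _) (⊓-cong x⊓y≈z⊓y (refl′ _)) ⟩
      (y ⊓ z) ⊓ ((z ⊓ y) ⊓ (y ⊓ x))    ≡⟨ ⊓-absorbˡ (y ⊓ x) (quot-comm y z) ⟩
      (z ⊓ y) ⊓ (y ⊓ x)                ≈⟨ ⊓-cong (sym′ x⊓y≈z⊓y) (refl′ _) ⟩
      (x ⊓ y) ⊓ (y ⊓ x)                ≡⟨ class-proj₂ (quot-comm x y) ⟩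
      y ⊓ x                            ≈⟨ x≈y⊓x ⟨
      x                                ∎)
      where
      x⊓y≈z⊓y : θ (x ⊓ y) (z ⊓ y)
      x⊓y≈z⊓y = trans′ (sym′ y≈x⊓y) y≈z⊓y

    MeetJoin-isCon : IsCon A (MeetJoin θ)
    MeetJoin-isCon = record
      { refl′  = λ x → θ⊆MeetJoin (refl′ x)
      ; sym′   = λ (x≈y⊓x , y≈x⊓y) → y≈x⊓y , x≈y⊓x
      ; trans′ = λ xy yz → MeetJoin-transˡ xy yz , MeetJoin-transˡ (swap yz) (swap xy)
      ; m-cong = λ {x} {x′} {y} {y′} (x≈ , x′≈) (y≈ , y′≈) →
          θ∘~∘θ⊆MeetJoin (m-cong x≈ y≈)
            (IsCongruence.m-cong ~-isCon (quot-comm x′ x) (quot-comm y′ y)) (sym′ (m-cong x′≈ y′≈))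
      ; p-cong = λ {x} {x′} {y} {y′} {z} {z′} (x≈ , x′≈) (y≈ , y′≈) (z≈ , z′≈) →
          θ∘~∘θ⊆MeetJoin (p-cong x≈ y≈ z≈)
            (IsCongruence.p-cong ~-isCon (quot-comm x′ x) (quot-comm y′ y) (quot-comm z′ z))
            (sym′ (p-cong x′≈ y′≈ z′≈))
      }
      where
      swap : ∀ {u v} → MeetJoin θ u v → MeetJoin θ v u
      swap (u≈ , v≈) = v≈ , u≈

  Join-Cg-~⇔MeetJoin : ∀ a b c e
    → Join A (Cg A a b) _~_ c e ⇔ (Cg A a b c (e ⊓ c) × Cg A a b e (c ⊓ e))
  Join-Cg-~⇔MeetJoin a b c e = mk⇔ to from
    where
    to : Join A (Cg A a b) _~_ c e → Cg A a b c (e ⊓ c) × Cg A a b e (c ⊓ e)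
    to c⟨Cg∨~⟩e = (λ θ θ-isCon θab → proj₁ (c⟨MeetJoin⟩e θ-isCon θab))
                 , (λ θ θ-isCon θab → proj₂ (c⟨MeetJoin⟩e θ-isCon θab))
      where
      c⟨MeetJoin⟩e : ∀ {θ} (θ-isCon : IsCon A θ) → θ a b → MeetJoin θ c e
      c⟨MeetJoin⟩e {θ} θ-isCon θab = c⟨Cg∨~⟩e (MeetJoin θ) (MeetJoin-isCon θ-isCon)
        (λ _ _ u⟨Cg⟩v → θ⊆MeetJoin θ-isCon (u⟨Cg⟩v θ θ-isCon θab))
        (λ _ _ → ~⊆MeetJoin θ-isCon)

    from : Cg A a b c (e ⊓ c) × Cg A a b e (c ⊓ e) → Join A (Cg A a b) _~_ c e
    from (c⟨Cg⟩e⊓c , e⟨Cg⟩c⊓e) ψ ψ-isCon Cg⊆ψ ~⊆ψ =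
      trans′ (Cg⊆ψ _ _ c⟨Cg⟩e⊓c) (trans′ (~⊆ψ _ _ (quot-comm e c)) (sym′ (Cg⊆ψ _ _ e⟨Cg⟩c⊓e)))
      where open IsCongruence ψ-isCon

corollary7p3 : {n : ℕ} (F : FinAlgebra n) → IsSMBVariety F
    → (A : Algebra) → InVariety F A
    → (_~_ : Algebra.Carrier A → Algebra.Carrier A → Set) → IsSMBAlg A _~_
    → (⊓ : Term (Fin 2)) (q : Term (Fin 3))
    → IsRegularSMB (binOp ⊓ A) (ternOp q A) _~_
    → (a b c e : Algebra.Carrier A)
    → Join A (Cg A a b) _~_ c e
      ⇔ (Cg A a b c (binOp ⊓ A e c) × Cg A a b e (binOp ⊓ A c e))
corollary7p3 F _ A _ _~_ smbA ⊓ q regular =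
  RegularReduct.Join-Cg-~⇔MeetJoin A _~_ (IsSMB.congr smbA) ⊓ q regular
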